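{- Let $Q' \subset Q$ be nonempty and such that $\delta(Q' \times \Sigma_k^*) \subset Q'$. Assume that a function $\rho\colon Q' \rightarrow Q'$ satisfies $\delta(\rho(q),j)= \rho(\delta(q,j))$ for each $q \in Q'$ and $j \in \Sigma_k$. Let $m \geq 1$ be minimal such that $\rho^m = \rho^j$ for some $j<m$. Choose a state $q' \in Q'$ and let $\beta_0, \ldots, \beta_{m-1} \in \mathbb{C}$. Then $$ \sum_{i=0}^{m-1} \beta_i f_{\rho^i(q)} = 0$$ for all $q \in \delta(\{q'\} \times \Sigma_k^*)$ if and only if $$\sum_{i=0}^{m-1} \beta_i \tau( \rho^i(q)) = 0$$ for all $q \in \delta(\{q'\} \times \Sigma_k^*)$.
   Context: Let $k\ge2$, $\Sigma_k=\{0,\ldots,k-1\}$, $\Sigma_k^*$ the set of finite words over $\Sigma_k$. Let $\mathcal{A} = (Q,\Sigma_k,\delta,q_0,\Delta,\tau)$ be a deterministic finite automaton with output, $Q=\{q_0,\ldots,q_{d-1}\}$, $\delta$ extended to words by $\delta(q,\epsilon)=q$, $\delta(q,wa)=\delta(\delta(q,w),a)$, output function $\tau\colon Q\to\Delta\subset\mathbb{C}$. For a state $q\in Q$, $f_q$ denotes the finite-state function $f_q(w)=\tau(\delta(q,w))$. -}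

module Defs where

open import Level using (Level)
open import Data.Nat using (ℕ; zero; suc)
open import Data.Fin using (Fin; toℕ)
open import Data.List using (List; foldl)
open import Algebra.Bundles using (CommutativeRing)
import Algebra.Properties.Monoid.Sum as MonoidSum

iter : ∀ {a} {A : Set a} → (A → A) → ℕ → A → A
iter f zero    x = x
iter f (suc n) x = f (iter f n x)

δ* : ∀ {d k} → (Fin d → Fin k → Fin d) → Fin d → List (Fin k) → Fin d
δ* δ q w = foldl δ q w

fstate : ∀ {d k c} {C : Set c} → (Fin d → Fin k → Fin d) → (Fin d → C)
       → Fin d → List (Fin k) → C
fstate δ τ q w = τ (δ* δ q w)

module _ {c ℓ} (R : CommutativeRing c ℓ) where
  open CommutativeRing R
  open MonoidSum +-monoid using (sum) public

{-# OPTIONS --safe #-}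
module Submission where

open import Defs
open import Data.Nat using (ℕ; zero; suc; _≤_; _<_)
open import Data.Fin using (Fin; toℕ)
open import Data.List using (List; []; _∷_; _++_)
open import Data.List.Properties using (foldl-++)
open import Data.Product using (Σ; ∃; _×_; _,_)
open import Relation.Nullary using (¬_)
open import Relation.Binary.PropositionalEquality
  using (_≡_; refl; sym; trans; cong)
open import Function.Bundles using (_⇔_; mk⇔)
open import Algebra.Bundles using (CommutativeRing)
import Algebra.Properties.Monoid.Sum as MonoidSum

-- ρ commutes with δ on the δ-closed set Q', hence so does every power ρ^i,
-- so f_{ρ^i(q)}(w) = τ(ρ^i(δ(q, w))).  Evaluated at w, the combination
-- Σ β_i f_{ρ^i(q)} is thus Σ β_i τ(ρ^i(q'')) for the state q'' = δ(q, w),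
-- which is again reachable from q'.  Neither k ≥ 2 nor the choice of m
-- plays any role in this equivalence.

module _ {a} {A : Set a} {f : A → A} (P : A → Set) (f-pres : ∀ x → P x → P (f x)) where

  iter-preserves : ∀ n x → P x → P (iter f n x)
  iter-preserves zero    x p = p
  iter-preserves (suc n) x p = f-pres _ (iter-preserves n x p)

  iter-commute : (g : A → A) → (∀ x → P x → g (f x) ≡ f (g x)) →
                 ∀ n x → P x → g (iter f n x) ≡ iter f n (g x)
  iter-commute g comm zero    x p = refl
  iter-commute g comm (suc n) x p =
    trans (comm _ (iter-preserves n x p)) (cong f (iter-commute g comm n x p))

module _ {d k} (δ : Fin d → Fin k → Fin d) where

  δ*-++ : ∀ q u w → δ* δ (δ* δ q u) w ≡ δ* δ q (u ++ w)
  δ*-++ q u w = sym (foldl-++ δ q u w)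

  δ*-commute : (Q' : Fin d → Set) → (∀ q → Q' q → (j : Fin k) → Q' (δ q j)) →
               (ρ : Fin d → Fin d) → (∀ q → Q' q → (j : Fin k) → δ (ρ q) j ≡ ρ (δ q j)) →
               ∀ q → Q' q → (w : List (Fin k)) → δ* δ (ρ q) w ≡ ρ (δ* δ q w)
  δ*-commute Q' δ-pres ρ comm q p []      = refl
  δ*-commute Q' δ-pres ρ comm q p (j ∷ w) =
    trans (cong (λ x → δ* δ x w) (comm q p j))
          (δ*-commute Q' δ-pres ρ comm (δ q j) (δ-pres q p j) w)

  fstate-iter : (Q' : Fin d → Set) → (∀ q → Q' q → (j : Fin k) → Q' (δ q j)) →
                (ρ : Fin d → Fin d) → (∀ q → Q' q → Q' (ρ q)) →
                (∀ q → Q' q → (j : Fin k) → δ (ρ q) j ≡ ρ (δ q j)) →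
                ∀ {c} {C : Set c} (τ : Fin d → C) n q → Q' q → (w : List (Fin k)) →
                fstate δ τ (iter ρ n q) w ≡ τ (iter ρ n (δ* δ q w))
  fstate-iter Q' δ-pres ρ ρ-pres comm τ n q p w =
    cong τ (iter-commute Q' ρ-pres (λ x → δ* δ x w)
                         (λ x px → δ*-commute Q' δ-pres ρ comm x px w) n q p)

proposition6p6 : ∀ {c ℓ} (R : CommutativeRing c ℓ) →
    let open CommutativeRing R renaming (Carrier to C) in
    (k d : ℕ) → 2 ≤ k →
    (δ : Fin d → Fin k → Fin d) (q₀ : Fin d) (τ : Fin d → C) →
    (Q' : Fin d → Set) →
    (∃ λ q → Q' q) →
    (∀ q → Q' q → (w : List (Fin k)) → Q' (δ* δ q w)) →
    (ρ : Fin d → Fin d) →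
    (∀ q → Q' q → Q' (ρ q)) →
    (∀ q → Q' q → (j : Fin k) → δ (ρ q) j ≡ ρ (δ q j)) →
    (m : ℕ) → 1 ≤ m →
    (Σ ℕ λ j → j < m × (∀ q → Q' q → iter ρ m q ≡ iter ρ j q)) →
    (∀ m' → 1 ≤ m' → m' < m →
    ¬ (Σ ℕ λ j → j < m' × (∀ q → Q' q → iter ρ m' q ≡ iter ρ j q))) →
    (q' : Fin d) → Q' q' →
    (β : Fin m → C) →
    ((∀ (u : List (Fin k)) (w : List (Fin k)) →
    sum R (λ i → β i * fstate δ τ (iter ρ (toℕ i) (δ* δ q' u)) w) ≈ 0#)
    ⇔
    (∀ (u : List (Fin k)) →
    sum R (λ i → β i * τ (iter ρ (toℕ i) (δ* δ q' u))) ≈ 0#))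
proposition6p6 R k d _ δ _ τ Q' _ δ*-pres ρ ρ-pres comm m _ _ _ q' q'∈Q' β =
  mk⇔ (λ vanish u → vanish u []) vanish-on-all-words
  where
  open CommutativeRing R using (_≈_; _*_; 0#; +-monoid; reflexive) renaming (trans to ≈-trans)
  open MonoidSum +-monoid using (sum-cong-≗)

  δ-pres : ∀ q → Q' q → (j : Fin k) → Q' (δ q j)
  δ-pres q p j = δ*-pres q p (j ∷ [])

  vanish-on-all-words :
    (∀ u → sum R (λ i → β i * τ (iter ρ (toℕ i) (δ* δ q' u))) ≈ 0#) →
    ∀ u w → sum R (λ i → β i * fstate δ τ (iter ρ (toℕ i) (δ* δ q' u)) w) ≈ 0#
  vanish-on-all-words vanish u w =
    ≈-trans (reflexive (sum-cong-≗ λ i → cong (β i *_) (rewrite-term (toℕ i))))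
          (vanish (u ++ w))
    where
    rewrite-term : ∀ n → fstate δ τ (iter ρ n (δ* δ q' u)) w ≡ τ (iter ρ n (δ* δ q' (u ++ w)))
    rewrite-term n =
      trans (fstate-iter δ Q' δ-pres ρ ρ-pres comm τ n _ (δ*-pres q' q'∈Q' u) w)
            (cong (λ q → τ (iter ρ n q)) (δ*-++ δ q' u w))
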